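{- Let $\Phi$ be an irreducible crystallographic root system, $k$ a positive integer, $R$ a dominant region of the $k$-Catalan arrangement of $\Phi$, $B$ its pseudomaximal alcove, $t\le k$ a positive integer and $\alpha\in\Phi^+$. If $\langle x_0,\alpha\rangle>t$ for some $x_0\in R$, then $\langle x,\alpha\rangle>t$ for all $x\in B$.
   Context: $\Phi$ lies in a Euclidean space $V$ with inner product $\langle\cdot,\cdot\rangle$, simple system $S$, positive system $\Phi^+$. $H_\alpha^r=\{x\mid\langle x,\alpha\rangle=r\}$. The $k$-Catalan arrangement consists of $H_\alpha^r$, $\alpha\in\Phi$, $r\in\{0,\ldots,k\}$; regions are connected components of the complement; dominant means $\langle x,\alpha\rangle>0$ on $R$ for all $\alpha\in\Phi^+$. Alcoves are the connected components of the complement of all $H_\alpha^r$, $\alpha\in\Phi$, $r\in\mathbb{Z}$; $r(A,\alpha)$ is the unique integer $r$ with $r-1<\langle x,\alpha\rangle<r$ on $A$. Root poset: $\alpha\le\beta$ iff $\beta-\alpha\in\mathbb{N}$-span of $S$; ideals are down-closed. Geometric chains of ideals $(I_1\subseteq\cdots\subseteq I_k)$: with $J_i=\Phi^+\setminus I_i$, $(I_i+I_j)\cap\Phi^+\subseteq I_{i+j}$ for $i+j\le k$ and $(J_i+J_j)\cap\Phi^+\subseteq J_{i+j}$ for $i,j\in\{0,\ldots,k\}$ ($I_0=\varnothing$, $J_0=\Phi^+$, $J_i=J_k$ for $i>k$); positive if $S\subseteq I_k$. $\theta(R)=(I_1,\ldots,I_k)$, $I_i=\{\alpha\in\Phi^+\mid\langle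 x,\alpha\rangle<i\ \forall x\in R\}$, is a bijection from dominant regions onto geometric chains, restricting to bounded dominant regions $\leftrightarrow$ positive chains. $r_\alpha(\mathcal{I})=\min\{r_1+\cdots+r_m\mid\alpha=\alpha_1+\cdots+\alpha_m,\ \alpha_i\in I_{r_i}\}$. For a bounded dominant region $R'$ with $\mathcal{I}'=\theta(R')$ its maximal alcove is the alcove $B$ with $r(B,\alpha)=r_\alpha(\mathcal{I}')$ for all $\alpha\in\Phi^+$. For a dominant region $R$ with $\mathcal{I}=\theta(R)$, $\underline{\mathcal{I}}=(\underline{I}_1,\ldots,\underline{I}_{k+1})$ with $\underline{I}_i=I_i$ ($i\in[k]$), $\underline{I}_{k+1}=\bigcup_{i+j=k+1}((I_i+I_j)\cap\Phi^+)\cup I_k\cup S$, a positive geometric chain of $k+1$ ideals; $\underline{R}=\theta^{ -1}(\underline{\mathcal{I}})$ (a bounded dominant region of the $(k+1)$-Catalan arrangement); the pseudomaximal alcove of $R$ is the maximal alcove of $\underline{R}$.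
   Formalization: The space V is taken as ℚ^n with a rational Gram matrix for the inner product, so the roots and the points of R and B have rational coordinates. -}

module Defs where

open import Data.Nat as ℕ using (ℕ; zero; suc)
open import Data.Integer as ℤ using (ℤ; +_)
open import Data.Rational as ℚ using (ℚ; 0ℚ; 1ℚ; _/_)
open import Data.Vec as Vec using (Vec; []; _∷_; lookup; zipWith; replicate)
open import Data.Fin using (Fin)
open import Data.List as List using (List; []; _∷_)
open import Data.List.Membership.Propositional using (_∈_)
open import Data.List.Relation.Unary.All using (All)
open import Data.Product using (Σ; ∃; ∃-syntax; _×_; _,_; proj₁; proj₂)
open import Data.Sum using (_⊎_)
open import Data.Nat.ListAction using () renaming (sum to sumℕ)
open import Data.Bool using (Bool; true; false)
open import Relation.Binary.PropositionalEquality using (_≡_; _≢_)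
open import Relation.Nullary using (¬_)

-- Rational points of the Euclidean space V = ℚ^n; the inner product is
-- given by a symmetric positive definite Gram matrix G.

V : ℕ → Set
V n = Vec ℚ n

ℕ→ℚ : ℕ → ℚ
ℕ→ℚ r = + r / 1

ℤ→ℚ : ℤ → ℚ
ℤ→ℚ z = z / 1

2ℚ : ℚ
2ℚ = + 2 / 1

0V : ∀ {n} → V n
0V = replicate _ 0ℚ

_+V_ : ∀ {n} → V n → V n → V n
_+V_ = zipWith ℚ._+_

_-V_ : ∀ {n} → V n → V n → V n
_-V_ = zipWith ℚ._-_

_•_ : ∀ {n} → ℚ → V n → V n
c • x = Vec.map (c ℚ.*_) x

sumℚ : ∀ {m} → Vec ℚ m → ℚ
sumℚ = Vec.foldr _ ℚ._+_ 0ℚ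

sumV : ∀ {n} → List (V n) → V n
sumV = List.foldr _+V_ 0V

lincomb : ∀ {n m} → Vec ℚ m → Vec (V n) m → V n
lincomb c S = Vec.foldr _ _+V_ 0V (zipWith _•_ c S)

Gram : ℕ → Set
Gram n = Vec (Vec ℚ n) n

ip : ∀ {n} → Gram n → V n → V n → ℚ
ip G x y = sumℚ (zipWith (λ xi row → xi ℚ.* sumℚ (zipWith ℚ._*_ row y)) x G)

record IsInnerProduct {n : ℕ} (G : Gram n) : Set where
  field
    symmetric : ∀ i j → lookup (lookup G i) j ≡ lookup (lookup G j) i
    posdef    : ∀ (x : V n) → x ≢ 0V → 0ℚ ℚ.< ip G x x

record CrystRootSystem (n : ℕ) : Set where
  field
    G         : Gram n
    isIP      : IsInnerProduct G
    Φ         : List (V n)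
    nonzero   : ∀ {α} → α ∈ Φ → α ≢ 0V
    reduced   : ∀ {α} → α ∈ Φ → ∀ c → (c • α) ∈ Φ → c ≡ 1ℚ ⊎ c ≡ ℚ.- 1ℚ
    -- closed under the reflections s_α(β) = β - (2⟨β,α⟩/⟨α,α⟩) α
    reflect   : ∀ {α β} → α ∈ Φ → β ∈ Φ → ∀ c →
                c ℚ.* ip G α α ≡ 2ℚ ℚ.* ip G β α → (β -V (c • α)) ∈ Φ
    cryst     : ∀ {α β} → α ∈ Φ → β ∈ Φ →
                ∃[ z ] ℤ→ℚ z ℚ.* ip G α α ≡ 2ℚ ℚ.* ip G β α

Irreducible : ∀ {n} → CrystRootSystem n → Set
Irreducible {n} R =
  (∃[ α ] α ∈ Φ) ×
  ((P : V n → Bool) →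
   (∀ {α β} → α ∈ Φ → β ∈ Φ → P α ≡ true → P β ≡ false → ip G α β ≡ 0ℚ) →
   All (λ α → P α ≡ true) Φ ⊎ All (λ α → P α ≡ false) Φ)
  where open CrystRootSystem R

record IsSimpleSystem {n m : ℕ} (R : CrystRootSystem n) (S : Vec (V n) m) : Set where
  open CrystRootSystem R
  field
    inΦ       : ∀ i → lookup S i ∈ Φ
    linIndep  : ∀ (c : Vec ℚ m) → lincomb c S ≡ 0V → c ≡ replicate m 0ℚ
    signs     : ∀ {β} → β ∈ Φ → ∃[ c ] (β ≡ lincomb c S ×
                  ((∀ i → 0ℚ ℚ.≤ lookup c i) ⊎ (∀ i → lookup c i ℚ.≤ 0ℚ)))

module _ {n m : ℕ} (R : CrystRootSystem n) (S : Vec (V n) m) where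
  open CrystRootSystem R

  ⟨_,_⟩ : V n → V n → ℚ
  ⟨ x , y ⟩ = ip G x y

  IsPos : V n → Set
  IsPos β = β ∈ Φ × ∃[ c ] (β ≡ lincomb c S × (∀ i → 0ℚ ℚ.≤ lookup c i))

  InS : V n → Set
  InS β = ∃[ i ] lookup S i ≡ β

  OffCatalan : ℕ → V n → Set
  OffCatalan k x = ∀ {α} → α ∈ Φ → ∀ r → r ℕ.≤ k → ⟨ x , α ⟩ ≢ ℕ→ℚ r

  -- The region of the k-Catalan arrangement containing the point p
  -- (p off the arrangement): y lies in it iff y is off the arrangement
  -- and on the same side as p of every hyperplane H_α^r.
  InRegion : ℕ → V n → V n → Set
  InRegion k p y = OffCatalan k y ×
    (∀ {α} → α ∈ Φ → ∀ r → r ℕ.≤ k →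
      (⟨ p , α ⟩ ℚ.< ℕ→ℚ r → ⟨ y , α ⟩ ℚ.< ℕ→ℚ r) ×
      (⟨ y , α ⟩ ℚ.< ℕ→ℚ r → ⟨ p , α ⟩ ℚ.< ℕ→ℚ r))

  Dominant : ℕ → V n → Set
  Dominant k p = ∀ {α} → IsPos α → ∀ x → InRegion k p x → 0ℚ ℚ.< ⟨ x , α ⟩

  InI : ℕ → V n → ℕ → V n → Set
  InI k p i α = IsPos α × (∀ x → InRegion k p x → ⟨ x , α ⟩ ℚ.< ℕ→ℚ i)

  InUI : ℕ → V n → ℕ → V n → Set
  InUI k p i α =
    (1 ℕ.≤ i × i ℕ.≤ k × InI k p i α) ⊎
    (i ≡ suc k ×
      ((IsPos α × ∃[ i₁ ] ∃[ j₁ ] (1 ℕ.≤ i₁ × 1 ℕ.≤ j₁ × i₁ ℕ.+ j₁ ≡ suc k ×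
          ∃[ γ ] ∃[ δ ] (InI k p i₁ γ × InI k p j₁ δ × γ +V δ ≡ α)))
       ⊎ InI k p k α
       ⊎ InS α))

  -- decompositions α = α_1 + ⋯ + α_m with α_j ∈ I̲_{r_j}
  -- (given as the list of pairs (α_j , r_j))
  IsDecomp : ℕ → V n → V n → List (V n × ℕ) → Set
  IsDecomp k p α ds =
    ds ≢ [] ×
    All (λ d → 1 ℕ.≤ proj₂ d × proj₂ d ℕ.≤ suc k × InUI k p (proj₂ d) (proj₁ d)) ds ×
    sumV (List.map proj₁ ds) ≡ α

  weight : List (V n × ℕ) → ℕ
  weight ds = sumℕ (List.map proj₂ ds)

  IsRVal : ℕ → V n → V n → ℕ → Set
  IsRVal k p α r =
    (∃[ ds ] (IsDecomp k p α ds × weight ds ≡ r)) ×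
    (∀ ds → IsDecomp k p α ds → r ℕ.≤ weight ds)

  -- x lies in the pseudomaximal alcove B of the region of p, i.e. the
  -- maximal alcove of R̲ = θ⁻¹(I̲), which is the alcove with
  -- r(B,α) = r_α(I̲) for all α ∈ Φ⁺:  r_α(I̲) - 1 < ⟨x,α⟩ < r_α(I̲).
  InPseudoMaxAlcove : ℕ → V n → V n → Set
  InPseudoMaxAlcove k p x =
    ∀ {α} → IsPos α → ∀ r → IsRVal k p α r →
      (ℕ→ℚ r ℚ.- 1ℚ ℚ.< ⟨ x , α ⟩) × (⟨ x , α ⟩ ℚ.< ℕ→ℚ r)

{-# OPTIONS --safe #-}
-- Every decomposition α = α₁ + ⋯ + αₘ with αⱼ ∈ I̲_{rⱼ} has weight r₁ + ⋯ + rₘ > t: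
-- either some rⱼ = k + 1 > t, or every αⱼ lies in I_{rⱼ}, so ⟨x₀, αⱼ⟩ < rⱼ and
-- t < ⟨x₀, α⟩ ≤ Σ rⱼ.  Hence r_α(I̲) > t, and every x ∈ B satisfies
-- ⟨x, α⟩ > r_α(I̲) − 1 ≥ t.
--
-- That r_α(I̲) exists needs one decomposition of α: write α as a sum of simple
-- roots, which all lie in I̲_{k+1}.  Every positive root is such a sum by descent:
-- some simple root s has ⟨α, s⟩ > 0, and then α = s or α − s is a positive root
-- whose coefficient sum is smaller by one.
module Submission where

open import Defs
import Data.Integer as ℤ
import Data.Integer.Properties as ℤP
open import Data.Nat as ℕ using (ℕ; zero; suc; z≤n; s≤s)
import Data.Nat.Properties as ℕP
open import Data.Nat.Induction using (<-rec)
open import Data.Nat.ListAction using () renaming (sum to sumℕ)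
open import Data.Rational as ℚ using (ℚ; 0ℚ; 1ℚ; _+_; _*_; -_; _-_)
import Data.Rational.Properties as ℚP
open import Data.Rational.Unnormalised as ℚᵘ using (mkℚᵘ; *≡*; *≤*; *<*)
import Data.Rational.Unnormalised.Properties as ℚᵘP
open import Data.Rational.Solver using (module +-*-Solver)
open import Data.Fin using (Fin; zero; suc)
import Data.Fin.Properties as FinP
open import Data.Vec using (Vec; []; _∷_; lookup; zipWith; replicate)
import Data.Vec.Properties as VecP
open import Data.List as List using (List; []; _∷_)
import Data.List.Properties as ListP
open import Data.List.Membership.Propositional using (_∈_)
open import Data.List.Relation.Unary.All as AllP using (All; []; _∷_)
import Data.List.Relation.Unary.All.Properties as AllP
open import Data.Product using (∃-syntax; _×_; _,_; proj₁; proj₂)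
open import Data.Sum as Sum using (_⊎_; inj₁; inj₂)
open import Data.Empty using (⊥; ⊥-elim)
open import Function using (_∘_)
open import Relation.Nullary using (¬_; yes; no)
open import Relation.Nullary.Decidable using (decidable-stable)
open import Relation.Binary.PropositionalEquality
open +-*-Solver

-- ℤ→ℚ i is definitionally fromℚᵘ (mkℚᵘ i 0).
ℤ→ℚ≃mkℚᵘ : ∀ i → ℚ.toℚᵘ (ℤ→ℚ i) ℚᵘ.≃ mkℚᵘ i 0
ℤ→ℚ≃mkℚᵘ i = ℚP.toℚᵘ-fromℚᵘ (mkℚᵘ i 0)

ℤ→ℚ-mono-≤ : ∀ {i j} → i ℤ.≤ j → ℤ→ℚ i ℚ.≤ ℤ→ℚ j
ℤ→ℚ-mono-≤ {i} {j} i≤j = ℚP.toℚᵘ-cancel-≤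
  (ℚᵘP.≤-respʳ-≃ (ℚᵘP.≃-sym (ℤ→ℚ≃mkℚᵘ j)) (ℚᵘP.≤-respˡ-≃ (ℚᵘP.≃-sym (ℤ→ℚ≃mkℚᵘ i))
    (*≤* (subst₂ ℤ._≤_ (sym (ℤP.*-identityʳ i)) (sym (ℤP.*-identityʳ j)) i≤j))))

ℤ→ℚ-cancel-< : ∀ {i j} → ℤ→ℚ i ℚ.< ℤ→ℚ j → i ℤ.< j
ℤ→ℚ-cancel-< {i} {j} i<j
  with ℚᵘP.<-respʳ-≃ (ℤ→ℚ≃mkℚᵘ j) (ℚᵘP.<-respˡ-≃ (ℤ→ℚ≃mkℚᵘ i) (ℚP.toℚᵘ-mono-< i<j))
... | *<* i*1<j*1 = subst₂ ℤ._<_ (ℤP.*-identityʳ i) (ℤP.*-identityʳ j) i*1<j*1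

ℤ→ℚ-+ : ∀ i j → ℤ→ℚ (i ℤ.+ j) ≡ ℤ→ℚ i + ℤ→ℚ j
ℤ→ℚ-+ i j = ℚP.toℚᵘ-injective (begin
  ℚ.toℚᵘ (ℤ→ℚ (i ℤ.+ j))               ≈⟨ ℤ→ℚ≃mkℚᵘ (i ℤ.+ j) ⟩
  mkℚᵘ (i ℤ.+ j) 0                      ≈⟨ *≡* (cong (ℤ._* ℤ.+ 1) (cong₂ ℤ._+_ (sym (ℤP.*-identityʳ i)) (sym (ℤP.*-identityʳ j)))) ⟩
  mkℚᵘ i 0 ℚᵘ.+ mkℚᵘ j 0                ≈⟨ ℚᵘP.+-cong (ℚᵘP.≃-sym (ℤ→ℚ≃mkℚᵘ i)) (ℚᵘP.≃-sym (ℤ→ℚ≃mkℚᵘ j)) ⟩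
  ℚ.toℚᵘ (ℤ→ℚ i) ℚᵘ.+ ℚ.toℚᵘ (ℤ→ℚ j)  ≈⟨ ℚᵘP.≃-sym (ℚP.toℚᵘ-homo-+ (ℤ→ℚ i) (ℤ→ℚ j)) ⟩
  ℚ.toℚᵘ (ℤ→ℚ i + ℤ→ℚ j)               ∎)
  where open ℚᵘP.≃-Reasoning

ℕ→ℚ-+ : ∀ a b → ℕ→ℚ (a ℕ.+ b) ≡ ℕ→ℚ a + ℕ→ℚ b
ℕ→ℚ-+ a b = ℤ→ℚ-+ (ℤ.+ a) (ℤ.+ b)

ℕ→ℚ-mono-≤ : ∀ {a b} → a ℕ.≤ b → ℕ→ℚ a ℚ.≤ ℕ→ℚ b
ℕ→ℚ-mono-≤ a≤b = ℤ→ℚ-mono-≤ (ℤ.+≤+ a≤b)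

ℕ→ℚ-cancel-< : ∀ {a b} → ℕ→ℚ a ℚ.< ℕ→ℚ b → a ℕ.< b
ℕ→ℚ-cancel-< a<b = ℤP.drop‿+<+ (ℤ→ℚ-cancel-< a<b)

ℕ→ℚ-suc-1 : ∀ a → ℕ→ℚ (suc a) - 1ℚ ≡ ℕ→ℚ a
ℕ→ℚ-suc-1 a = begin
  ℕ→ℚ (suc a) - 1ℚ       ≡⟨ cong (_- 1ℚ) (ℕ→ℚ-+ 1 a) ⟩
  (1ℚ + ℕ→ℚ a) - 1ℚ      ≡⟨ solve 1 (λ q → (con 1ℚ :+ q) :- con 1ℚ := q) refl (ℕ→ℚ a) ⟩
  ℕ→ℚ a                  ∎
  where open ≡-Reasoning

<⇒ℕ→ℚ-≤-pred : ∀ {a b} → a ℕ.< b → ℕ→ℚ a ℚ.≤ ℕ→ℚ b - 1ℚ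
<⇒ℕ→ℚ-≤-pred {a} {suc b} (s≤s a≤b) = subst (ℕ→ℚ a ℚ.≤_) (sym (ℕ→ℚ-suc-1 b)) (ℕ→ℚ-mono-≤ a≤b)

ℕ→ℚ-unbounded : ∀ q → ∃[ N ] q ℚ.≤ ℕ→ℚ N
ℕ→ℚ-unbounded (ℚ.mkℚ (ℤ.+ a) d _) = a , ℚP.toℚᵘ-cancel-≤ (ℚᵘP.≤-respʳ-≃ (ℚᵘP.≃-sym (ℤ→ℚ≃mkℚᵘ (ℤ.+ a)))
  (*≤* (subst₂ ℤ._≤_ (sym (ℤP.*-identityʳ (ℤ.+ a))) (ℤP.pos-* a (suc d)) (ℤ.+≤+ (ℕP.m≤m*n a (suc d))))))
ℕ→ℚ-unbounded (ℚ.mkℚ ℤ.-[1+ a ] d _) = 0 , ℚP.toℚᵘ-cancel-≤ (ℚᵘP.≤-respʳ-≃ (ℚᵘP.≃-sym (ℤ→ℚ≃mkℚᵘ (ℤ.+ 0))) (*≤* ℤ.-≤+))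

<⇒≱ : ∀ {p q} → p ℚ.< q → ¬ q ℚ.≤ p
<⇒≱ p<q q≤p = ℚP.<-irrefl refl (ℚP.<-≤-trans p<q q≤p)

p-q≡0⇒p≡q : ∀ {p q} → p - q ≡ 0ℚ → p ≡ q
p-q≡0⇒p≡q {p} {q} p-q≡0 = begin
  p              ≡⟨ solve 2 (λ p q → p := (p :- q) :+ q) refl p q ⟩
  (p - q) + q    ≡⟨ cong (_+ q) p-q≡0 ⟩
  0ℚ + q         ≡⟨ ℚP.+-identityˡ q ⟩
  q              ∎
  where open ≡-Reasoning

p≤q⇒p-q≤0 : ∀ {p q} → p ℚ.≤ q → p - q ℚ.≤ 0ℚ
p≤q⇒p-q≤0 {p} {q} p≤q = subst (p - q ℚ.≤_) (ℚP.+-inverseʳ q) (ℚP.+-monoˡ-≤ (- q) p≤q)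

0<p*q⇒0<p : ∀ {p q} → 0ℚ ℚ.≤ q → 0ℚ ℚ.< p * q → 0ℚ ℚ.< p
0<p*q⇒0<p {p} {q} 0≤q 0<pq =
  ℚP.*-cancelʳ-<-nonNeg q {{ℚ.nonNegative 0≤q}} (subst (ℚ._< p * q) (sym (ℚP.*-zeroˡ q)) 0<pq)

0<ℤ→ℚ⇒≡1⊎2≤ : ∀ z → 0ℚ ℚ.< ℤ→ℚ z → ℤ→ℚ z ≡ 1ℚ ⊎ 2ℚ ℚ.≤ ℤ→ℚ z
0<ℤ→ℚ⇒≡1⊎2≤ z 0<z with ℤ→ℚ-cancel-< {ℤ.+ 0} {z} 0<z
... | ℤ.+<+ (s≤s {n = zero} _)  = inj₁ refl
... | ℤ.+<+ (s≤s {n = suc k} _) = inj₂ (ℤ→ℚ-mono-≤ {ℤ.+ 2} {ℤ.+ suc (suc k)} (ℤ.+≤+ (s≤s (s≤s z≤n))))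

2≤c∧c*p≡2*q⇒p≤q : ∀ {c p q} → 0ℚ ℚ.≤ p → 2ℚ ℚ.≤ c → c * p ≡ 2ℚ * q → p ℚ.≤ q
2≤c∧c*p≡2*q⇒p≤q {c} {p} {q} 0≤p 2≤c c*p≡2*q = ℚP.*-cancelˡ-≤-pos 2ℚ
  (subst (2ℚ * p ℚ.≤_) c*p≡2*q (ℚP.*-monoʳ-≤-nonNeg p {{ℚ.nonNegative 0≤p}} 2≤c))

≡-by-lookup : ∀ {A : Set} {n} {xs ys : Vec A n} → (∀ i → lookup xs i ≡ lookup ys i) → xs ≡ ys
≡-by-lookup {xs = xs} {ys} xsᵢ≡ysᵢ =
  trans (sym (VecP.tabulate∘lookup xs)) (trans (VecP.tabulate-cong xsᵢ≡ysᵢ) (VecP.tabulate∘lookup ys))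

-V-≡0⇒≡ : ∀ {n} (x y : V n) → x -V y ≡ 0V → x ≡ y
-V-≡0⇒≡ []      []      _   = refl
-V-≡0⇒≡ (a ∷ x) (b ∷ y) x-y≡0 =
  cong₂ _∷_ (p-q≡0⇒p≡q (VecP.∷-injectiveˡ x-y≡0)) (-V-≡0⇒≡ x y (VecP.∷-injectiveʳ x-y≡0))

-V-self : ∀ {n} (x : V n) → x -V x ≡ 0V
-V-self []      = refl
-V-self (a ∷ x) = cong₂ _∷_ (ℚP.+-inverseʳ a) (-V-self x)

+V-identityʳ : ∀ {n} (x : V n) → x +V 0V ≡ x
+V-identityʳ = VecP.zipWith-identityʳ ℚP.+-identityʳ

+V--V-cancel : ∀ {n} (x y : V n) → y +V (x -V y) ≡ x
+V--V-cancel []      []      = refl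
+V--V-cancel (a ∷ x) (b ∷ y) =
  cong₂ _∷_ (solve 2 (λ a b → b :+ (a :- b) := a) refl a b) (+V--V-cancel x y)

•-identityˡ : ∀ {n} (x : V n) → 1ℚ • x ≡ x
•-identityˡ []      = refl
•-identityˡ (a ∷ x) = cong₂ _∷_ (ℚP.*-identityˡ a) (•-identityˡ x)

-V-2•-negate : ∀ {n} (x y : V n) → (y -V x) -V (2ℚ • (y -V x)) ≡ x -V y
-V-2•-negate []      []      = refl
-V-2•-negate (a ∷ x) (b ∷ y) =
  cong₂ _∷_ (solve 2 (λ a b → (b :- a) :- con 2ℚ :* (b :- a) := a :- b) refl a b) (-V-2•-negate x y)

NonNeg : ∀ {m} → Vec ℚ m → Set
NonNeg c = ∀ i → 0ℚ ℚ.≤ lookup c i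

single : ∀ {m} → Fin m → ℚ → Vec ℚ m
single zero    a = a ∷ 0V
single (suc i) a = 0ℚ ∷ single i a

lookup-single-≡ : ∀ {m} (i : Fin m) a → lookup (single i a) i ≡ a
lookup-single-≡ zero    a = refl
lookup-single-≡ (suc i) a = lookup-single-≡ i a

lookup-single-≢ : ∀ {m} {i j : Fin m} a → i ≢ j → lookup (single i a) j ≡ 0ℚ
lookup-single-≢ {i = zero}  {zero}  a i≢j = ⊥-elim (i≢j refl)
lookup-single-≢ {i = zero}  {suc j} a _   = VecP.lookup-replicate j 0ℚ
lookup-single-≢ {i = suc i} {zero}  a _   = refl
lookup-single-≢ {i = suc i} {suc j} a i≢j = lookup-single-≢ a (i≢j ∘ cong suc)

sumℚ-zero : ∀ m → sumℚ (0V {m}) ≡ 0ℚ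
sumℚ-zero zero    = refl
sumℚ-zero (suc m) = trans (cong (0ℚ +_) (sumℚ-zero m)) (ℚP.+-identityˡ 0ℚ)

sumℚ-single : ∀ {m} (i : Fin m) a → sumℚ (single i a) ≡ a
sumℚ-single {suc m} zero a = trans (cong (a +_) (sumℚ-zero m)) (ℚP.+-identityʳ a)
sumℚ-single (suc i) a = trans (cong (0ℚ +_) (sumℚ-single i a)) (ℚP.+-identityˡ a)

sumℚ--V : ∀ {m} (u v : Vec ℚ m) → sumℚ (u -V v) ≡ sumℚ u - sumℚ v
sumℚ--V []      []      = refl
sumℚ--V (a ∷ u) (b ∷ v) = trans (cong ((a - b) +_) (sumℚ--V u v))
  (solve 4 (λ a b p q → (a :- b) :+ (p :- q) := (a :+ p) :- (b :+ q)) refl a b (sumℚ u) (sumℚ v))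

sumℚ-nonNeg : ∀ {m} (c : Vec ℚ m) → NonNeg c → 0ℚ ℚ.≤ sumℚ c
sumℚ-nonNeg []      _      = ℚP.≤-refl
sumℚ-nonNeg (a ∷ c) 0≤a∷c = ℚP.+-mono-≤ (0≤a∷c zero) (sumℚ-nonNeg c (0≤a∷c ∘ suc))

lookup≤sumℚ : ∀ {m} (c : Vec ℚ m) → NonNeg c → ∀ i → lookup c i ℚ.≤ sumℚ c
lookup≤sumℚ (a ∷ c) 0≤a∷c zero =
  subst (ℚ._≤ a + sumℚ c) (ℚP.+-identityʳ a) (ℚP.+-monoʳ-≤ a (sumℚ-nonNeg c (λ i → 0≤a∷c (suc i))))
lookup≤sumℚ (a ∷ c) 0≤a∷c (suc i) =
  subst (ℚ._≤ a + sumℚ c) (ℚP.+-identityˡ _) (ℚP.+-mono-≤ (0≤a∷c zero) (lookup≤sumℚ c (λ i → 0≤a∷c (suc i)) i))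

0<sumℚ⇒∃0<lookup : ∀ {m} (u : Vec ℚ m) → 0ℚ ℚ.< sumℚ u → ∃[ i ] 0ℚ ℚ.< lookup u i
0<sumℚ⇒∃0<lookup []      0<0 = ⊥-elim (ℚP.<-irrefl refl 0<0)
0<sumℚ⇒∃0<lookup (a ∷ u) 0<sum with 0ℚ ℚ.<? a | 0ℚ ℚ.<? sumℚ u
... | yes 0<a | _        = zero , 0<a
... | no _    | yes 0<su = let i , 0<uᵢ = 0<sumℚ⇒∃0<lookup u 0<su in suc i , 0<uᵢ
... | no a≯0  | no su≯0  =
  ⊥-elim (<⇒≱ 0<sum (ℚP.+-mono-≤ (ℚP.≮⇒≥ a≯0) (ℚP.≮⇒≥ su≯0)))

0•+V : ∀ {n} (x y : V n) → (0ℚ • x) +V y ≡ y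
0•+V []      []      = refl
0•+V (a ∷ x) (b ∷ y) = cong₂ _∷_ (solve 2 (λ a b → con 0ℚ :* a :+ b := b) refl a b) (0•+V x y)

•+V--V-distrib : ∀ {n} p q (s x y : V n) → ((p - q) • s) +V (x -V y) ≡ ((p • s) +V x) -V ((q • s) +V y)
•+V--V-distrib p q []      []      []      = refl
•+V--V-distrib p q (a ∷ s) (b ∷ x) (c ∷ y) = cong₂ _∷_
  (solve 5 (λ p q a b c → (p :- q) :* a :+ (b :- c) := (p :* a :+ b) :- (q :* a :+ c)) refl p q a b c)
  (•+V--V-distrib p q s x y)

lincomb-zero : ∀ {n m} (S : Vec (V n) m) → lincomb 0V S ≡ 0V
lincomb-zero []      = refl
lincomb-zero (s ∷ S) = trans (0•+V s _) (lincomb-zero S)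

lincomb--V : ∀ {n m} (u v : Vec ℚ m) (S : Vec (V n) m) → lincomb (u -V v) S ≡ lincomb u S -V lincomb v S
lincomb--V []      []      []      = sym (-V-self 0V)
lincomb--V (a ∷ u) (b ∷ v) (s ∷ S) =
  trans (cong (((a - b) • s) +V_) (lincomb--V u v S)) (•+V--V-distrib a b s (lincomb u S) (lincomb v S))

lincomb-single : ∀ {n m} (i : Fin m) a (S : Vec (V n) m) → lincomb (single i a) S ≡ a • lookup S i
lincomb-single zero    a (s ∷ S) = trans (cong ((a • s) +V_) (lincomb-zero S)) (+V-identityʳ (a • s))
lincomb-single (suc i) a (s ∷ S) = trans (0•+V s _) (lincomb-single i a S)

dot : ∀ {n} → Vec ℚ n → Vec ℚ n → ℚ
dot x y = sumℚ (zipWith _*_ x y)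

bilinear : ∀ {n k} → Vec (Vec ℚ n) k → Vec ℚ k → Vec ℚ n → ℚ
bilinear M x y = sumℚ (zipWith (λ xᵢ row → xᵢ * dot row y) x M)

bilinear-+ˡ : ∀ {n k} (M : Vec (Vec ℚ n) k) x x′ y → bilinear M (x +V x′) y ≡ bilinear M x y + bilinear M x′ y
bilinear-+ˡ []      []      []        y = refl
bilinear-+ˡ (r ∷ M) (a ∷ x) (b ∷ x′) y = trans (cong ((a + b) * dot r y +_) (bilinear-+ˡ M x x′ y))
  (solve 5 (λ a b d p q → (a :+ b) :* d :+ (p :+ q) := (a :* d :+ p) :+ (b :* d :+ q))
    refl a b (dot r y) (bilinear M x y) (bilinear M x′ y))

bilinear--ˡ : ∀ {n k} (M : Vec (Vec ℚ n) k) x x′ y → bilinear M (x -V x′) y ≡ bilinear M x y - bilinear M x′ y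
bilinear--ˡ []      []      []        y = refl
bilinear--ˡ (r ∷ M) (a ∷ x) (b ∷ x′) y = trans (cong ((a - b) * dot r y +_) (bilinear--ˡ M x x′ y))
  (solve 5 (λ a b d p q → (a :- b) :* d :+ (p :- q) := (a :* d :+ p) :- (b :* d :+ q))
    refl a b (dot r y) (bilinear M x y) (bilinear M x′ y))

bilinear-•ˡ : ∀ {n k} (M : Vec (Vec ℚ n) k) c x y → bilinear M (c • x) y ≡ c * bilinear M x y
bilinear-•ˡ []      c []      y = sym (ℚP.*-zeroʳ c)
bilinear-•ˡ (r ∷ M) c (a ∷ x) y = trans (cong ((c * a) * dot r y +_) (bilinear-•ˡ M c x y))
  (solve 4 (λ c a d p → (c :* a) :* d :+ c :* p := c :* (a :* d :+ p))
    refl c a (dot r y) (bilinear M x y))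

bilinear-0ˡ : ∀ {n k} (M : Vec (Vec ℚ n) k) y → bilinear M 0V y ≡ 0ℚ
bilinear-0ˡ []      y = refl
bilinear-0ˡ (r ∷ M) y = trans (cong (0ℚ * dot r y +_) (bilinear-0ˡ M y))
  (solve 1 (λ d → con 0ℚ :* d :+ con 0ℚ := con 0ℚ) refl (dot r y))

transpose : ∀ {n k} → Vec (Vec ℚ n) k → Vec (Vec ℚ k) n
transpose []        = replicate _ []
transpose (r ∷ M) = zipWith _∷_ r (transpose M)

lookup-transpose : ∀ {n k} (M : Vec (Vec ℚ n) k) i j → lookup (lookup (transpose M) i) j ≡ lookup (lookup M j) i
lookup-transpose (r ∷ M) i zero    = cong (λ v → lookup v zero) (VecP.lookup-zipWith _∷_ i r (transpose M))
lookup-transpose (r ∷ M) i (suc j) =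
  trans (cong (λ v → lookup v (suc j)) (VecP.lookup-zipWith _∷_ i r (transpose M))) (lookup-transpose M i j)

bilinear-[] : ∀ {n} (y : Vec ℚ n) → bilinear (replicate n []) y [] ≡ 0ℚ
bilinear-[] []      = refl
bilinear-[] (b ∷ y) = trans (cong (b * 0ℚ +_) (bilinear-[] y)) (solve 1 (λ b → b :* con 0ℚ :+ con 0ℚ := con 0ℚ) refl b)

bilinear-∷ʳ : ∀ {n k} (r : Vec ℚ n) (M : Vec (Vec ℚ k) n) y a x →
  bilinear (zipWith _∷_ r M) y (a ∷ x) ≡ a * dot r y + bilinear M y x
bilinear-∷ʳ []      []      []      a x = solve 1 (λ a → con 0ℚ := a :* con 0ℚ :+ con 0ℚ) refl a
bilinear-∷ʳ (c ∷ r) (g ∷ M) (b ∷ y) a x = trans (cong (b * (c * a + dot g x) +_) (bilinear-∷ʳ r M y a x))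
  (solve 6 (λ a b c d D I → b :* (c :* a :+ d) :+ (a :* D :+ I) := a :* (c :* b :+ D) :+ (b :* d :+ I))
    refl a b c (dot g x) (dot r y) (bilinear M y x))

bilinear-transpose : ∀ {n k} (M : Vec (Vec ℚ n) k) x y → bilinear M x y ≡ bilinear (transpose M) y x
bilinear-transpose []      []      y = sym (bilinear-[] y)
bilinear-transpose (r ∷ M) (a ∷ x) y =
  trans (cong (a * dot r y +_) (bilinear-transpose M x y)) (sym (bilinear-∷ʳ r (transpose M) y a x))

module InnerProduct {n : ℕ} {G : Gram n} (isIP : IsInnerProduct G) where
  open IsInnerProduct isIP

  ip-sym : ∀ x y → ip G x y ≡ ip G y x
  ip-sym x y = trans (bilinear-transpose G x y) (cong (λ M → bilinear M y x) transpose-G)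
    where
    transpose-G : transpose G ≡ G
    transpose-G = ≡-by-lookup λ i → ≡-by-lookup λ j → trans (lookup-transpose G i j) (symmetric j i)

  ip-+ʳ : ∀ x y y′ → ip G x (y +V y′) ≡ ip G x y + ip G x y′
  ip-+ʳ x y y′ = trans (ip-sym x _) (trans (bilinear-+ˡ G y y′ x) (cong₂ _+_ (ip-sym y x) (ip-sym y′ x)))

  ip--ʳ : ∀ x y y′ → ip G x (y -V y′) ≡ ip G x y - ip G x y′
  ip--ʳ x y y′ = trans (ip-sym x _) (trans (bilinear--ˡ G y y′ x) (cong₂ _-_ (ip-sym y x) (ip-sym y′ x)))

  ip-0ʳ : ∀ x → ip G x 0V ≡ 0ℚ
  ip-0ʳ x = trans (ip-sym x 0V) (bilinear-0ˡ G x)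

  ip-lincombˡ : ∀ {m} (c : Vec ℚ m) (S : Vec (V n) m) y →
                ip G (lincomb c S) y ≡ sumℚ (zipWith (λ cᵢ sᵢ → cᵢ * ip G sᵢ y) c S)
  ip-lincombˡ []       []      y = bilinear-0ˡ G y
  ip-lincombˡ (c ∷ cs) (s ∷ S) y = begin
    ip G ((c • s) +V lincomb cs S) y          ≡⟨ bilinear-+ˡ G (c • s) (lincomb cs S) y ⟩
    ip G (c • s) y + ip G (lincomb cs S) y    ≡⟨ cong₂ _+_ (bilinear-•ˡ G c s y) (ip-lincombˡ cs S y) ⟩
    c * ip G s y + _                          ∎
    where open ≡-Reasoning

  ip-self--V : ∀ x y → ip G (x -V y) (x -V y) ≡ (ip G x x - ip G y x) + (ip G y y - ip G x y)
  ip-self--V x y = begin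
    ip G (x -V y) (x -V y)                                ≡⟨ bilinear--ˡ G x y (x -V y) ⟩
    ip G x (x -V y) - ip G y (x -V y)                     ≡⟨ cong₂ _-_ (ip--ʳ x x y) (ip--ʳ y x y) ⟩
    (ip G x x - ip G x y) - (ip G y x - ip G y y)         ≡⟨ solve 4 (λ a b c d → (a :- b) :- (c :- d) := (a :- c) :+ (d :- b))
                                                               refl (ip G x x) (ip G x y) (ip G y x) (ip G y y) ⟩
    (ip G x x - ip G y x) + (ip G y y - ip G x y)         ∎
    where open ≡-Reasoning

  ip-self≤0⇒≡0 : ∀ x → ip G x x ℚ.≤ 0ℚ → x ≡ 0V
  ip-self≤0⇒≡0 x xx≤0 with VecP.≡-dec ℚP._≟_ x 0V
  ... | yes x≡0 = x≡0
  ... | no x≢0  = ⊥-elim (<⇒≱ (posdef x x≢0) xx≤0)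

  weight≥⊎pairing≤weight : ∀ K x (ds : List (V n × ℕ)) →
    All (λ d → K ℕ.≤ proj₂ d ⊎ ip G x (proj₁ d) ℚ.≤ ℕ→ℚ (proj₂ d)) ds →
    K ℕ.≤ sumℕ (List.map proj₂ ds) ⊎ ip G x (sumV (List.map proj₁ ds)) ℚ.≤ ℕ→ℚ (sumℕ (List.map proj₂ ds))
  weight≥⊎pairing≤weight K x []       []                = inj₂ (ℚP.≤-reflexive (ip-0ʳ x))
  weight≥⊎pairing≤weight K x (d ∷ ds) (inj₁ K≤r ∷ _)     = inj₁ (ℕP.≤-trans K≤r (ℕP.m≤m+n (proj₂ d) _))
  weight≥⊎pairing≤weight K x (d ∷ ds) (inj₂ xβ≤r ∷ rest) with weight≥⊎pairing≤weight K x ds rest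
  ... | inj₁ K≤w  = inj₁ (ℕP.≤-trans K≤w (ℕP.m≤n+m _ (proj₂ d)))
  ... | inj₂ xΣ≤w = inj₂ (subst₂ ℚ._≤_ (sym (ip-+ʳ x (proj₁ d) _)) (sym (ℕ→ℚ-+ (proj₂ d) _)) (ℚP.+-mono-≤ xβ≤r xΣ≤w))

module RootSystem {n : ℕ} (R : CrystRootSystem n) where
  open CrystRootSystem R
  open InnerProduct isIP
  open IsInnerProduct isIP using (posdef)

  cartan-integer : ∀ {α β} → α ∈ Φ → β ∈ Φ → 0ℚ ℚ.< ip G β α →
                   ∃[ c ] (c * ip G α α ≡ 2ℚ * ip G β α × (c ≡ 1ℚ ⊎ 2ℚ ℚ.≤ c))
  cartan-integer {α} {β} αΦ βΦ 0<βα with cryst αΦ βΦ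
  ... | z , z*αα≡2βα = ℤ→ℚ z , z*αα≡2βα , 0<ℤ→ℚ⇒≡1⊎2≤ z 0<z
    where
    0<z : 0ℚ ℚ.< ℤ→ℚ z
    0<z = 0<p*q⇒0<p (ℚP.<⇒≤ (posdef α (nonzero αΦ)))
            (subst (0ℚ ℚ.<_) (sym z*αα≡2βα) (ℚP.positive⁻¹ _ {{ℚP.pos*pos⇒pos 2ℚ (ip G β α) {{ℚ.positive 0<βα}}}}))

  acute⇒≡⊎-V∈Φ : ∀ {α β} → α ∈ Φ → β ∈ Φ → 0ℚ ℚ.< ip G α β → α ≡ β ⊎ (α -V β) ∈ Φ
  acute⇒≡⊎-V∈Φ {α} {β} αΦ βΦ 0<αβ
    with cartan-integer βΦ αΦ 0<αβ | cartan-integer αΦ βΦ (subst (0ℚ ℚ.<_) (ip-sym α β) 0<αβ)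
  ... | z , z*ββ≡2αβ , inj₁ z≡1 | _ =
    inj₂ (subst (_∈ Φ) (cong (α -V_) (•-identityˡ β))
      (reflect βΦ αΦ 1ℚ (subst (λ c → c * ip G β β ≡ 2ℚ * ip G α β) z≡1 z*ββ≡2αβ)))
  ... | _ | w , w*αα≡2βα , inj₁ w≡1 =
    -- reflecting β in α gives β − α, and reflecting β − α in itself gives α − β
    inj₂ (subst (_∈ Φ) (-V-2•-negate α β) (reflect β-αΦ β-αΦ 2ℚ refl))
    where
    β-αΦ : (β -V α) ∈ Φ
    β-αΦ = subst (_∈ Φ) (cong (β -V_) (•-identityˡ α))
      (reflect αΦ βΦ 1ℚ (subst (λ c → c * ip G α α ≡ 2ℚ * ip G β α) w≡1 w*αα≡2βα))
  ... | z , z*ββ≡2αβ , inj₂ 2≤z | w , w*αα≡2βα , inj₂ 2≤w =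
    -- both Cartan integers ≥ 2 make ⟨α − β, α − β⟩ ≤ 0
    inj₁ (-V-≡0⇒≡ α β (ip-self≤0⇒≡0 (α -V β) (subst (ℚ._≤ 0ℚ) (sym (ip-self--V α β))
      (ℚP.+-mono-≤ (p≤q⇒p-q≤0 αα≤βα) (p≤q⇒p-q≤0 ββ≤αβ)))))
    where
    αα≤βα : ip G α α ℚ.≤ ip G β α
    αα≤βα = 2≤c∧c*p≡2*q⇒p≤q (ℚP.<⇒≤ (posdef α (nonzero αΦ))) 2≤w w*αα≡2βα
    ββ≤αβ : ip G β β ℚ.≤ ip G α β
    ββ≤αβ = 2≤c∧c*p≡2*q⇒p≤q (ℚP.<⇒≤ (posdef β (nonzero βΦ))) 2≤z z*ββ≡2αβ

nonNeg∧-single-nonPos⇒≡single : ∀ {m} (c : Vec ℚ m) i → NonNeg c →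
  (∀ j → lookup (c -V single i 1ℚ) j ℚ.≤ 0ℚ) → c ≡ single i (lookup c i)
nonNeg∧-single-nonPos⇒≡single c i 0≤c c-eᵢ≤0 = ≡-by-lookup cⱼ≡
  where
  cⱼ≡ : ∀ j → lookup c j ≡ lookup (single i (lookup c i)) j
  cⱼ≡ j with i FinP.≟ j
  ... | yes refl = sym (lookup-single-≡ i (lookup c i))
  ... | no i≢j   = trans (ℚP.≤-antisym cⱼ≤0 (0≤c j)) (sym (lookup-single-≢ (lookup c i) i≢j))
    where
    cⱼ≤0 : lookup c j ℚ.≤ 0ℚ
    cⱼ≤0 = subst (ℚ._≤ 0ℚ)
      (trans (VecP.lookup-zipWith _-_ j c (single i 1ℚ))
        (trans (cong (λ e → lookup c j - e) (lookup-single-≢ 1ℚ i≢j)) (ℚP.+-identityʳ (lookup c j))))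
      (c-eᵢ≤0 j)

sumℚ--single≤ : ∀ {m} (c : Vec ℚ m) i N → sumℚ c ℚ.≤ ℕ→ℚ (suc N) → sumℚ (c -V single i 1ℚ) ℚ.≤ ℕ→ℚ N
sumℚ--single≤ c i N Σc≤1+N = begin
  sumℚ (c -V single i 1ℚ)           ≡⟨ sumℚ--V c (single i 1ℚ) ⟩
  sumℚ c - sumℚ (single i 1ℚ)       ≡⟨ cong (λ e → sumℚ c - e) (sumℚ-single i 1ℚ) ⟩
  sumℚ c - 1ℚ                       ≤⟨ ℚP.+-monoˡ-≤ (- 1ℚ) Σc≤1+N ⟩
  ℕ→ℚ (suc N) - 1ℚ                  ≡⟨ ℕ→ℚ-suc-1 N ⟩
  ℕ→ℚ N                             ∎
  where open ℚP.≤-Reasoning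

SumOfSimple : ∀ {n m} → Vec (V n) m → V n → Set
SumOfSimple S α = ∃[ is ] sumV (List.map (lookup S) is) ≡ α

module SimpleSystem {n m : ℕ} (R : CrystRootSystem n) (S : Vec (V n) m) (SS : IsSimpleSystem R S) where
  open CrystRootSystem R
  open IsSimpleSystem SS
  open InnerProduct isIP
  open IsInnerProduct isIP using (posdef)
  open RootSystem R

  lincomb-injective : ∀ u v → lincomb u S ≡ lincomb v S → u ≡ v
  lincomb-injective u v eq =
    -V-≡0⇒≡ u v (linIndep (u -V v) (trans (lincomb--V u v S) (trans (cong (_-V lincomb v S) eq) (-V-self _))))

  lincomb--simple : ∀ {α} c i → α ≡ lincomb c S → α -V lookup S i ≡ lincomb (c -V single i 1ℚ) S
  lincomb--simple {α} c i α≡ = sym (begin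
    lincomb (c -V single i 1ℚ) S                   ≡⟨ lincomb--V c (single i 1ℚ) S ⟩
    lincomb c S -V lincomb (single i 1ℚ) S         ≡⟨ cong₂ _-V_ (sym α≡) (lincomb-single i 1ℚ S) ⟩
    α -V (1ℚ • lookup S i)                         ≡⟨ cong (α -V_) (•-identityˡ (lookup S i)) ⟩
    α -V lookup S i                                ∎)
    where open ≡-Reasoning

  ∃simple-acute : ∀ {α} c → α ∈ Φ → α ≡ lincomb c S → NonNeg c →
                  ∃[ i ] (0ℚ ℚ.< lookup c i × 0ℚ ℚ.< ip G α (lookup S i))
  ∃simple-acute {α} c αΦ α≡ 0≤c = i , 0<cᵢ , subst (0ℚ ℚ.<_) (ip-sym (lookup S i) α) 0<sᵢα
    where
    pairings : Vec ℚ m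
    pairings = zipWith (λ cᵢ sᵢ → cᵢ * ip G sᵢ α) c S
    positive-pairing : ∃[ i ] 0ℚ ℚ.< lookup pairings i
    positive-pairing = 0<sumℚ⇒∃0<lookup pairings
      (subst (0ℚ ℚ.<_) (trans (cong (λ x → ip G x α) α≡) (ip-lincombˡ c S α)) (posdef α (nonzero αΦ)))
    i : Fin m
    i = proj₁ positive-pairing
    0<cᵢsᵢα : 0ℚ ℚ.< lookup c i * ip G (lookup S i) α
    0<cᵢsᵢα = subst (0ℚ ℚ.<_) (VecP.lookup-zipWith _ i c S) (proj₂ positive-pairing)
    0<sᵢα : 0ℚ ℚ.< ip G (lookup S i) α
    0<sᵢα = 0<p*q⇒0<p (0≤c i) (subst (0ℚ ℚ.<_) (ℚP.*-comm (lookup c i) _) 0<cᵢsᵢα)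
    0<cᵢ : 0ℚ ℚ.< lookup c i
    0<cᵢ = 0<p*q⇒0<p (ℚP.<⇒≤ 0<sᵢα) 0<cᵢsᵢα

  coefficients--simple : ∀ {α} c d i → α ≡ lincomb c S → α -V lookup S i ≡ lincomb d S → d ≡ c -V single i 1ℚ
  coefficients--simple c d i α≡ α-sᵢ≡ = lincomb-injective d _ (trans (sym α-sᵢ≡) (lincomb--simple c i α≡))

  nonPos--simple⇒-simple∉Φ : ∀ {α} c i → α ∈ Φ → α ≡ lincomb c S → NonNeg c →
    (∀ j → lookup (c -V single i 1ℚ) j ℚ.≤ 0ℚ) → ¬ (α -V lookup S i) ∈ Φ
  nonPos--simple⇒-simple∉Φ {α} c i αΦ α≡ 0≤c c-eᵢ≤0 α-sᵢΦ =
    multiple-of-simple (reduced (inΦ i) cᵢ (subst (_∈ Φ) α≡cᵢsᵢ αΦ))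
    where
    cᵢ : ℚ
    cᵢ = lookup c i
    α≡cᵢsᵢ : α ≡ cᵢ • lookup S i
    α≡cᵢsᵢ = trans α≡ (trans (cong (λ v → lincomb v S) (nonNeg∧-single-nonPos⇒≡single c i 0≤c c-eᵢ≤0))
                               (lincomb-single i cᵢ S))
    multiple-of-simple : cᵢ ≡ 1ℚ ⊎ cᵢ ≡ - 1ℚ → ⊥
    multiple-of-simple (inj₁ cᵢ≡1) = nonzero α-sᵢΦ (trans
      (cong (_-V lookup S i) (trans α≡cᵢsᵢ (trans (cong (_• lookup S i) cᵢ≡1) (•-identityˡ (lookup S i)))))
      (-V-self (lookup S i)))
    multiple-of-simple (inj₂ cᵢ≡-1) = <⇒≱ (ℚ.*<* ℤ.-<+) (subst (0ℚ ℚ.≤_) cᵢ≡-1 (0≤c i))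

  nonNeg--simple : ∀ {α} c i → α ∈ Φ → α ≡ lincomb c S → NonNeg c → (α -V lookup S i) ∈ Φ → NonNeg (c -V single i 1ℚ)
  nonNeg--simple c i αΦ α≡ 0≤c α-sᵢΦ with signs α-sᵢΦ
  ... | d , α-sᵢ≡d , inj₁ 0≤d = subst NonNeg (coefficients--simple c d i α≡ α-sᵢ≡d) 0≤d
  ... | d , α-sᵢ≡d , inj₂ d≤0 = ⊥-elim (nonPos--simple⇒-simple∉Φ c i αΦ α≡ 0≤c
    (λ j → subst (λ v → lookup v j ℚ.≤ 0ℚ) (coefficients--simple c d i α≡ α-sᵢ≡d) (d≤0 j)) α-sᵢΦ)

  sum-of-simple-bounded : ∀ N {α} c → α ∈ Φ → α ≡ lincomb c S → NonNeg c → sumℚ c ℚ.≤ ℕ→ℚ N → SumOfSimple S α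
  sum-of-simple-bounded N {α} c αΦ α≡ 0≤c Σc≤N with ∃simple-acute c αΦ α≡ 0≤c
  ... | i , 0<cᵢ , 0<αsᵢ with acute⇒≡⊎-V∈Φ αΦ (inΦ i) 0<αsᵢ
  ...   | inj₁ α≡sᵢ  = (i ∷ []) , trans (+V-identityʳ (lookup S i)) (sym α≡sᵢ)
  ...   | inj₂ α-sᵢΦ = descend N Σc≤N
    where
    -- the coefficient sum drops by one from α to α − sᵢ
    descend : ∀ N → sumℚ c ℚ.≤ ℕ→ℚ N → SumOfSimple S α
    descend zero    Σc≤0   = ⊥-elim (<⇒≱ 0<cᵢ (ℚP.≤-trans (lookup≤sumℚ c 0≤c i) Σc≤0))
    descend (suc N) Σc≤1+N =
      let is , Σis≡α-sᵢ = sum-of-simple-bounded N (c -V single i 1ℚ) α-sᵢΦ (lincomb--simple c i α≡)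
                            (nonNeg--simple c i αΦ α≡ 0≤c α-sᵢΦ) (sumℚ--single≤ c i N Σc≤1+N)
      in (i ∷ is) , trans (cong (lookup S i +V_) Σis≡α-sᵢ) (+V--V-cancel α (lookup S i))

  positive⇒sum-of-simple : ∀ {α} → IsPos R S α → SumOfSimple S α
  positive⇒sum-of-simple (αΦ , c , α≡ , 0≤c) =
    let N , Σc≤N = ℕ→ℚ-unbounded (sumℚ c) in sum-of-simple-bounded N c αΦ α≡ 0≤c Σc≤N

¬¬-minimum : ∀ {a p} {A : Set a} (P : A → Set p) (f : A → ℕ) {x} → P x →
             ¬ ¬ (∃[ r ] (∃[ y ] (P y × f y ≡ r)) × (∀ y → P y → r ℕ.≤ f y))
¬¬-minimum P f {x} Px no-minimum = not-attained (f x) (x , Px , refl)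
  where
  not-attained : ∀ r → ¬ (∃[ y ] (P y × f y ≡ r))
  not-attained = <-rec _ λ r below attained →
    no-minimum (r , attained , λ y Py → ℕP.≮⇒≥ λ fy<r → below fy<r (y , Py , refl))

module Catalan {n m : ℕ} (R : CrystRootSystem n) (S : Vec (V n) m) (k : ℕ) (p : V n) where
  open CrystRootSystem R
  open InnerProduct isIP

  top-part⊎pairing< : ∀ {r β} x₀ → InRegion R S k p x₀ → InUI R S k p r β → suc k ℕ.≤ r ⊎ ip G x₀ β ℚ.< ℕ→ℚ r
  top-part⊎pairing< x₀ x₀∈R (inj₁ (_ , _ , _ , below)) = inj₂ (below x₀ x₀∈R)
  top-part⊎pairing< x₀ x₀∈R (inj₂ (r≡1+k , _))         = inj₁ (ℕP.≤-reflexive (sym r≡1+k))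

  decomposition-weight> : ∀ {t α ds} x₀ → InRegion R S k p x₀ → t ℕ.≤ k → ℕ→ℚ t ℚ.< ip G x₀ α →
                          IsDecomp R S k p α ds → t ℕ.< weight R S ds
  decomposition-weight> {ds = ds} x₀ x₀∈R t≤k t<x₀α (_ , parts , Σ≡α)
    with weight≥⊎pairing≤weight (suc k) x₀ ds (AllP.map (λ (_ , _ , d∈I̲) → Sum.map₂ ℚP.<⇒≤ (top-part⊎pairing< x₀ x₀∈R d∈I̲)) parts)
  ... | inj₁ 1+k≤w  = ℕP.<-≤-trans (s≤s t≤k) 1+k≤w
  ... | inj₂ x₀Σ≤w = ℕ→ℚ-cancel-< (ℚP.<-≤-trans t<x₀α (subst (λ v → ip G x₀ v ℚ.≤ _) Σ≡α x₀Σ≤w))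

  simple-decomposition : ∀ {α} → α ≢ 0V → SumOfSimple S α → ∃[ ds ] IsDecomp R S k p α ds
  simple-decomposition α≢0 ([] , 0≡α) = ⊥-elim (α≢0 (sym 0≡α))
  simple-decomposition _ (i ∷ is , Σ≡α) =
    List.map simple-part (i ∷ is) ,
    (λ ()) ,
    AllP.map⁺ (AllP.universal (λ j → s≤s z≤n , ℕP.≤-refl , inj₂ (refl , inj₂ (inj₂ (j , refl)))) (i ∷ is)) ,
    trans (cong sumV (sym (ListP.map-∘ (i ∷ is)))) Σ≡α
    where
    simple-part : Fin m → V n × ℕ
    simple-part j = lookup S j , suc k

lemma8 : ∀ {n m} (R : CrystRootSystem n) → Irreducible R →
         (S : Vec (V n) m) → IsSimpleSystem R S →
         (k : ℕ) → 1 ℕ.≤ k →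
         (p : V n) → OffCatalan R S k p → Dominant R S k p →
         (t : ℕ) → 1 ℕ.≤ t → t ℕ.≤ k →
         (α : V n) → IsPos R S α →
         (∃[ x₀ ] (InRegion R S k p x₀ × ℕ→ℚ t ℚ.< ⟨_,_⟩ R S x₀ α)) →
         ∀ x → InPseudoMaxAlcove R S k p x → ℕ→ℚ t ℚ.< ⟨_,_⟩ R S x α
-- r_α(I̲) is a minimum over infinitely many decompositions, so it exists only up
-- to double negation; the goal is decidable.
lemma8 R _ S SS k _ p _ _ t _ t≤k α α⁺@(αΦ , _) (x₀ , x₀∈R , t<x₀α) x x∈B =
  decidable-stable (ℕ→ℚ t ℚ.<? ip G x α) λ t≮xα →
    ¬¬-minimum (IsDecomp R S k p α) (weight R S) (proj₂ decomposition) λ (r , rα@((ds , ds-dec , w≡r) , _)) →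
      t≮xα (ℚP.≤-<-trans (<⇒ℕ→ℚ-≤-pred (subst (t ℕ.<_) w≡r (decomposition-weight> x₀ x₀∈R t≤k t<x₀α ds-dec)))
                         (proj₁ (x∈B α⁺ r rα)))
  where
  open CrystRootSystem R using (G; nonzero)
  open SimpleSystem R S SS using (positive⇒sum-of-simple)
  open Catalan R S k p using (decomposition-weight>; simple-decomposition)

  decomposition : ∃[ ds ] IsDecomp R S k p α ds
  decomposition = simple-decomposition (nonzero αΦ) (positive⇒sum-of-simple α⁺)
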